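{- Fix $n\ge 1$. Let $H=(h_{a,b})_{0\le a\le b\le n}$ be an $h$-array, and let $T_1=T_1(H)=(x^{(i)}_j)$, $T_2=T_2(H)=(y^{(i)}_j)$, $T_3=T_3(H)=(z^{(i)}_j)$ be its derived $t$-arrays. Then: (1) $H$ satisfies RC(1) if and only if $T_1$ satisfies IC(2) and $T_2$ satisfies IC(1); (2) $H$ satisfies RC(2) if and only if $T_1$ and $T_3$ both satisfy IC(1); (3) $H$ satisfies RC(3) if and only if $T_2$ and $T_3$ both satisfy IC(2); (4) $T_3$ satisfies IC(1) if and only if $T_1$ satisfies IC(1); (5) $T_3$ satisfies IC(2) if and only if $T_2$ satisfies IC(2).
   Context: A $t$-array is an array of integers $T=(t^{(i)}_j)_{1\le j\le i\le n}$. It satisfies IC(1) if $t^{(i+1)}_j\ge t^{(i)}_j$ for all $1\le j\le i\le n-1$, and IC(2) if $t^{(i)}_j\ge t^{(i+1)}_{j+1}$ for all $1\le j\le i\le n-1$. An $h$-array is an array of nonnegative integers $H=(h_{a,b})_{0\le a\le b\le n}$ with $h_{0,0}=0$. The rhombus conditions are: RC(1): $h_{a,b}+h_{a-1,b-1}\ge h_{a-1,b}+h_{a,b-1}$ for $1\le a<b\le n$; RC(2): $h_{a-1,b}+h_{a,b}\ge h_{a,b+1}+h_{a-1,b-1}$ for $1\le a\le b<n$; RC(3): $h_{a,b}+h_{a,b+1}\ge h_{a+1,b+1}+h_{a-1,b}$ for $1\le a\le b<n$. The derived $t$-arrays $T_1(H)=(x^{(i)}_j)$, $T_2(H)=(y^{(i)}_j)$,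 $T_3(H)=(z^{(i)}_j)$ are defined, for $0\le a\le b\le n-1$, by $x^{(n-a)}_{b+1-a}=h_{a,b+1}-h_{a,b}$, $y^{(b+1)}_{a+1}=h_{a+1,b+1}-h_{a,b+1}$, $z^{(n+a-b)}_{a+1}=h_{a+1,b+1}-h_{a,b}$ (these determine every entry of each $t$-array). -}

module Defs where

open import Data.Nat as ℕ using (ℕ; suc; _∸_)
open import Data.Integer as ℤ using (ℤ; +_; _-_)
open import Data.Product using (_×_)
open import Relation.Binary.PropositionalEquality using (_≡_)

-- An h-array (h_{a,b})_{0≤a≤b≤n}: nonnegative integers, represented as a
-- function ℕ → ℕ → ℕ; only the values at 0 ≤ a ≤ b ≤ n are meaningful.
HArray : Set
HArray = ℕ → ℕ → ℕ

IsHArray : HArray → Set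
IsHArray h = h 0 0 ≡ 0

-- A t-array (t^{(i)}_j)_{1≤j≤i≤n}: integers, t i j = t^{(i)}_j;
-- only the values at 1 ≤ j ≤ i ≤ n are meaningful.
TArray : Set
TArray = ℕ → ℕ → ℤ

IC1 : ℕ → TArray → Set
IC1 n t = ∀ i j → 1 ℕ.≤ j → j ℕ.≤ i → i ℕ.≤ n ∸ 1 → t i j ℤ.≤ t (suc i) j

IC2 : ℕ → TArray → Set
IC2 n t = ∀ i j → 1 ℕ.≤ j → j ℕ.≤ i → i ℕ.≤ n ∸ 1 → t (suc i) (suc j) ℤ.≤ t i j

hz : HArray → ℕ → ℕ → ℤ
hz h a b = + (h a b)

RC1 : ℕ → HArray → Set
RC1 n h = ∀ a b → 1 ℕ.≤ a → a ℕ.< b → b ℕ.≤ n →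
  h (a ∸ 1) b ℕ.+ h a (b ∸ 1) ℕ.≤ h a b ℕ.+ h (a ∸ 1) (b ∸ 1)

RC2 : ℕ → HArray → Set
RC2 n h = ∀ a b → 1 ℕ.≤ a → a ℕ.≤ b → b ℕ.< n →
  h a (suc b) ℕ.+ h (a ∸ 1) (b ∸ 1) ℕ.≤ h (a ∸ 1) b ℕ.+ h a b

RC3 : ℕ → HArray → Set
RC3 n h = ∀ a b → 1 ℕ.≤ a → a ℕ.≤ b → b ℕ.< n →
  h (suc a) (suc b) ℕ.+ h (a ∸ 1) b ℕ.≤ h a b ℕ.+ h a (suc b)

-- Solving the defining equations for (i, j) with
-- 1 ≤ j ≤ i ≤ n:
--  x^{(n-a)}_{b+1-a} = h_{a,b+1} - h_{a,b}:  a = n-i, b = n-i+j-1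
--  y^{(b+1)}_{a+1}   = h_{a+1,b+1} - h_{a,b+1}:  a = j-1, b = i-1
--  z^{(n+a-b)}_{a+1} = h_{a+1,b+1} - h_{a,b}:  a = j-1, b = n+j-1-i
T₁ : ℕ → HArray → TArray
T₁ n h i j = hz h (n ∸ i) (n ∸ i ℕ.+ j) - hz h (n ∸ i) (n ∸ i ℕ.+ j ∸ 1)

T₂ : ℕ → HArray → TArray
T₂ n h i j = hz h j i - hz h (j ∸ 1) i

T₃ : ℕ → HArray → TArray
T₃ n h i j = hz h j (n ℕ.+ j ∸ i) - hz h (j ∸ 1) (n ℕ.+ j ∸ 1 ∸ i)

module Submission where

-- Each rhombus condition RC(k) on an h-array compares two sums of two
-- h-entries, and each entry of a derived t-array is a difference of two
-- h-entries.  Rewriting  x + y ≤ z + w  as  x - w ≤ z - y  therefore turns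
-- a single rhombus inequality into a single interlacing inequality.
--
-- All nine conditions range over the same index set, the pairs p < q < n
-- (a "triangle").  We parametrise it by gap triples (p, d, e) with
-- q = p + 1 + d and n = q + 1 + e, i.e. p + d + e + 2 = n.  In these
-- coordinates an RC instance matches an IC instance at the same triple
-- (for T₂), at the cyclically rotated triple (for T₁), or at the triple
-- with d and e swapped (for T₃); both permutations preserve the gap sum.
--
-- Parts (1)-(5) then follow by pairing and
-- composing these equivalences.

open import Defs
open import Data.Nat using (ℕ; _≤_)
open import Data.Product using (_×_)
open import Function.Bundles using (_⇔_)

open import Data.Nat as ℕ using (suc; zero; _+_; _∸_; z≤n; s≤s; s≤s⁻¹)
open import Data.Nat.Properties using (+-suc; +-comm; m≤m+n; m+n∸n≡m; m+n∸m≡n; m≤n⇒∃[o]m+o≡n)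
import Data.Nat.Tactic.RingSolver as ℕ-Solver
open import Data.Integer as ℤ using (ℤ; +_; +≤+)
open import Data.Integer.Properties using (+-monoˡ-≤; pos-+; drop‿+≤+)
import Data.Integer.Tactic.RingSolver as ℤ-Solver
open import Data.List using ([]; _∷_)
open import Data.Product using (_,_; proj₁)
open import Function.Bundles using (mk⇔; Equivalence)
open import Function.Base using (_$_)
open import Function.Properties.Equivalence using (⇔-setoid) renaming (trans to ⇔-trans; sym to ⇔-sym)
open import Relation.Binary.PropositionalEquality using (_≡_; refl; trans; cong; cong₂; subst; subst₂)
open import Level using (0ℓ)
open import Relation.Binary.Reasoning.Setoid (⇔-setoid 0ℓ)

≤⇔+-≤+ : ∀ (c : ℤ) {a b : ℤ} → a ℤ.≤ b ⇔ a ℤ.+ c ℤ.≤ b ℤ.+ c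
≤⇔+-≤+ c {a} {b} = mk⇔ (+-monoˡ-≤ c) λ a+c≤b+c →
  subst₂ ℤ._≤_ (add-sub a) (add-sub b) (+-monoˡ-≤ (ℤ.- c) a+c≤b+c)
  where
  add-sub : ∀ x → x ℤ.+ c ℤ.+ ℤ.- c ≡ x
  add-sub x = ℤ-Solver.solve (x ∷ c ∷ [])

sum≤sum⇔diff≤diff-ℤ : ∀ (a b c d : ℤ) → a ℤ.+ b ℤ.≤ c ℤ.+ d ⇔ a ℤ.- d ℤ.≤ c ℤ.- b
sum≤sum⇔diff≤diff-ℤ a b c d =
  subst₂ (λ u v → (a ℤ.+ b ℤ.≤ c ℤ.+ d) ⇔ (u ℤ.≤ v)) left right (≤⇔+-≤+ (ℤ.- (b ℤ.+ d)))
  where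
  left : a ℤ.+ b ℤ.+ ℤ.- (b ℤ.+ d) ≡ a ℤ.- d
  left = ℤ-Solver.solve (a ∷ b ∷ d ∷ [])
  right : c ℤ.+ d ℤ.+ ℤ.- (b ℤ.+ d) ≡ c ℤ.- b
  right = ℤ-Solver.solve (c ∷ d ∷ b ∷ [])

sum≤sum⇔diff≤diff : ∀ (x y z w : ℕ) → x + y ≤ z + w ⇔ (+ x ℤ.- + w ℤ.≤ + z ℤ.- + y)
sum≤sum⇔diff≤diff x y z w =
  ⇔-trans (subst₂ (λ u v → (x + y ≤ z + w) ⇔ (u ℤ.≤ v)) (pos-+ x y) (pos-+ z w)
                  (mk⇔ +≤+ drop‿+≤+))
          (sum≤sum⇔diff≤diff-ℤ (+ x) (+ y) (+ z) (+ w))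

sum≤sum⇔diff≤diff-left : ∀ (x y z w : ℕ) → x + y ≤ z + w ⇔ (+ y ℤ.- + w ℤ.≤ + z ℤ.- + x)
sum≤sum⇔diff≤diff-left x y z w =
  subst (λ s → (s ≤ z + w) ⇔ (+ y ℤ.- + w ℤ.≤ + z ℤ.- + x)) (+-comm y x)
        (sum≤sum⇔diff≤diff y x z w)

sum≤sum⇔diff≤diff-right : ∀ (x y z w : ℕ) → x + y ≤ z + w ⇔ (+ x ℤ.- + z ℤ.≤ + w ℤ.- + y)
sum≤sum⇔diff≤diff-right x y z w =
  subst (λ s → (x + y ≤ s) ⇔ (+ x ℤ.- + z ℤ.≤ + w ℤ.- + y)) (+-comm w z)
        (sum≤sum⇔diff≤diff x y w z)

IC1-at : TArray → ℕ → ℕ → Set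
IC1-at t i j = t i j ℤ.≤ t (suc i) j

IC2-at : TArray → ℕ → ℕ → Set
IC2-at t i j = t (suc i) (suc j) ℤ.≤ t i j

RC1-at : HArray → ℕ → ℕ → Set
RC1-at h a b = h (a ∸ 1) b + h a (b ∸ 1) ≤ h a b + h (a ∸ 1) (b ∸ 1)

RC2-at : HArray → ℕ → ℕ → Set
RC2-at h a b = h a (suc b) + h (a ∸ 1) (b ∸ 1) ≤ h (a ∸ 1) b + h a b

RC3-at : HArray → ℕ → ℕ → Set
RC3-at h a b = h (suc a) (suc b) + h (a ∸ 1) b ≤ h a b + h a (suc b)

∸-cancel : ∀ {i b m} → i + b ≡ m → m ∸ i ≡ b
∸-cancel {i} {b} refl = m+n∸m≡n i b

T₁-entry : ∀ {n} (h : HArray) {c i j b} → c + i ≡ n → c + j ≡ suc b →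
  T₁ n h i j ≡ hz h c (suc b) ℤ.- hz h c b
T₁-entry h {c} {i} refl c+j≡1+b rewrite m+n∸n≡m c i | c+j≡1+b = refl

T₃-entry : ∀ {n} (h : HArray) {i k b} → i + b ≡ n + k →
  T₃ n h i (suc k) ≡ hz h (suc k) (suc b) ℤ.- hz h k b
T₃-entry {n} h {i} {k} {b} i+b≡n+k =
  cong₂ (λ u v → hz h (suc k) u ℤ.- hz h k v) upper lower
  where
  upper : n + suc k ∸ i ≡ suc b
  upper = trans (cong (_∸ i) (+-suc n k)) (∸-cancel (trans (+-suc i b) (cong suc i+b≡n+k)))
  lower : n + suc k ∸ 1 ∸ i ≡ b
  lower = trans (cong (λ m → m ∸ 1 ∸ i) (+-suc n k)) (∸-cancel i+b≡n+k)

Triangle : ℕ → (ℕ → ℕ → Set) → Set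
Triangle n P = ∀ p q → suc p ≤ q → suc q ≤ n → P p q

IC-triangle : ∀ {n} (P : ℕ → ℕ → Set) → 1 ≤ n →
  (∀ i j → 1 ≤ j → j ≤ i → i ≤ n ∸ 1 → P i j) ⇔ Triangle n (λ p q → P q (suc p))
IC-triangle {suc n} P _ = mk⇔
  (λ f p q p<q q<n → f q (suc p) (s≤s z≤n) p<q (s≤s⁻¹ q<n))
  (λ { t i zero () _ _ ; t i (suc k) _ k<i i≤n → t k i k<i (s≤s i≤n) })

RC≤-triangle : ∀ {n} (P : ℕ → ℕ → Set) →
  (∀ a b → 1 ≤ a → a ≤ b → b ℕ.< n → P a b) ⇔ Triangle n (λ p q → P (suc p) q)
RC≤-triangle P = mk⇔
  (λ f p q p<q q<n → f (suc p) q (s≤s z≤n) p<q q<n)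
  (λ { t zero b () _ _ ; t (suc p) b _ p<b b<n → t p b p<b b<n })

RC<-triangle : ∀ {n} (P : ℕ → ℕ → Set) →
  (∀ a b → 1 ≤ a → a ℕ.< b → b ≤ n → P a b) ⇔ Triangle n (λ p q → P (suc p) (suc q))
RC<-triangle P = mk⇔
  (λ f p q p<q q<n → f (suc p) (suc q) (s≤s z≤n) (s≤s p<q) q<n)
  (λ { t zero b () _ _ ; t (suc p) zero _ () _
     ; t (suc p) (suc q) _ (s≤s p<q) q<n → t p q p<q q<n })

-- Gap coordinates: (p, q) = (p, p + 1 + d) lies in the triangle of size
-- n = q + 1 + e exactly when p + d + e + 2 = n.
Gap : ℕ → ℕ → ℕ → ℕ → Set
Gap n p d e = suc (suc (p + d + e)) ≡ n

AllGaps : ℕ → (ℕ → ℕ → ℕ → Set) → Set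
AllGaps n R = ∀ p d e → Gap n p d e → R p d e

triangle⇔gaps : ∀ {n} (P : ℕ → ℕ → Set) → Triangle n P ⇔ AllGaps n (λ p d e → P p (suc p + d))
triangle⇔gaps {n} P = mk⇔ to from
  where
  to : Triangle n P → AllGaps n (λ p d e → P p (suc p + d))
  to t p d e gap = t p (suc p + d) (m≤m+n (suc p) d) (subst (suc (suc p + d) ≤_) gap (m≤m+n _ e))
  from : AllGaps n (λ p d e → P p (suc p + d)) → Triangle n P
  from g p q p<q q<n with m≤n⇒∃[o]m+o≡n p<q | m≤n⇒∃[o]m+o≡n q<n
  ... | d , refl | e , gap = g p d e gap

gap-rotate : ∀ {n p d e} → Gap n p d e → Gap n e p d
gap-rotate {p = p} {d} {e} refl = cong (λ s → suc (suc s)) sum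
  where
  sum : e + p + d ≡ p + d + e
  sum = ℕ-Solver.solve (p ∷ d ∷ e ∷ [])

gap-swap : ∀ {n p d e} → Gap n p d e → Gap n p e d
gap-swap {p = p} {d} {e} refl = cong (λ s → suc (suc s)) sum
  where
  sum : p + e + d ≡ p + d + e
  sum = ℕ-Solver.solve (p ∷ d ∷ e ∷ [])

gaps-rotate : ∀ {n} (R : ℕ → ℕ → ℕ → Set) → AllGaps n R ⇔ AllGaps n (λ p d e → R e p d)
gaps-rotate R = mk⇔ (λ g p d e gap → g e p d (gap-rotate {p = p} {d} {e} gap))
                    (λ g p d e gap → g d e p (gap-rotate {p = e} {p} {d}
                                                  (gap-rotate {p = p} {d} {e} gap)))

gaps-swap : ∀ {n} (R : ℕ → ℕ → ℕ → Set) → AllGaps n R ⇔ AllGaps n (λ p d e → R p e d)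
gaps-swap R = mk⇔ (λ g p d e gap → g p e d (gap-swap {p = p} {d} {e} gap))
                  (λ g p d e gap → g p e d (gap-swap {p = p} {d} {e} gap))

gaps-cong : ∀ {n} {R S : ℕ → ℕ → ℕ → Set} →
  (∀ {p d e} → Gap n p d e → R p d e ⇔ S p d e) → AllGaps n R ⇔ AllGaps n S
gaps-cong R⇔S = mk⇔ (λ g p d e gap → Equivalence.to (R⇔S gap) (g p d e gap))
                    (λ g p d e gap → Equivalence.from (R⇔S gap) (g p d e gap))

by-entries : ∀ {P : Set} {s s′ t t′ : ℤ} → s ≡ s′ → t ≡ t′ →
  P ⇔ (s′ ℤ.≤ t′) → P ⇔ (s ℤ.≤ t)
by-entries refl refl P⇔s′≤t′ = P⇔s′≤t′

-- T₂ needs no reindexing: its interlacing inequalities at (q, p + 1) are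
-- literally the rhombus inequalities RC(1) and RC(3) at the same place.
rc1⇔ic1-T₂ : ∀ {n} (h : HArray) p q → RC1-at h (suc p) (suc q) ⇔ IC1-at (T₂ n h) q (suc p)
rc1⇔ic1-T₂ h p q = sum≤sum⇔diff≤diff-left (h p (suc q)) (h (suc p) q) (h (suc p) (suc q)) (h p q)

rc3⇔ic2-T₂ : ∀ {n} (h : HArray) p q → RC3-at h (suc p) q ⇔ IC2-at (T₂ n h) q (suc p)
rc3⇔ic2-T₂ h p q = sum≤sum⇔diff≤diff (h (suc (suc p)) (suc q)) (h p q) (h (suc p) q) (h (suc p) (suc q))

-- In gap coordinates (p, d, e), rows q = p + 1 + d and q + 1 of T₁ are
-- read off rows e + 1 and e of H.
T₁-row : ∀ p d e → suc e + (suc p + d) ≡ suc (suc (p + d + e))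
T₁-row = ℕ-Solver.solve-∀

T₁-next-row : ∀ p d e → e + suc (suc p + d) ≡ suc (suc (p + d + e))
T₁-next-row = ℕ-Solver.solve-∀

rc2⇔ic1-T₁ : ∀ {n} (h : HArray) {p d e} → Gap n p d e →
  RC2-at h (suc e) (suc e + p) ⇔ IC1-at (T₁ n h) (suc p + d) (suc p)
rc2⇔ic1-T₁ h {p} {d} {e} refl
  = by-entries (T₁-entry h {suc e} {suc p + d} {suc p} {suc e + p} (T₁-row p d e)
                          (cong suc (+-suc e p)))
               (T₁-entry h {e} {suc (suc p + d)} {suc p} {e + p} (T₁-next-row p d e) (+-suc e p))
  $ sum≤sum⇔diff≤diff (h (suc e) (suc (suc e + p))) (h e (e + p))
                      (h e (suc e + p)) (h (suc e) (suc e + p))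

rc1⇔ic2-T₁ : ∀ {n} (h : HArray) {p d e} → Gap n p d e →
  RC1-at h (suc e) (suc (suc e + p)) ⇔ IC2-at (T₁ n h) (suc p + d) (suc p)
rc1⇔ic2-T₁ h {p} {d} {e} refl
  = by-entries (T₁-entry h {e} {suc (suc p + d)} {suc (suc p)} {suc e + p} (T₁-next-row p d e)
                          (trans (+-suc e (suc p)) (cong suc (+-suc e p))))
               (T₁-entry h {suc e} {suc p + d} {suc p} {suc e + p} (T₁-row p d e)
                          (cong suc (+-suc e p)))
  $ sum≤sum⇔diff≤diff (h e (suc (suc e + p))) (h (suc e) (suc e + p))
                      (h (suc e) (suc (suc e + p))) (h e (suc e + p))

-- In gap coordinates the entries of T₃ at rows q = p + 1 + d and q + 1 lie
-- on the diagonals of H through column p + 1 + e and p + e.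
T₃-diagonal : ∀ p d e → suc p + d + (suc p + e) ≡ suc (suc (p + d + e)) + p
T₃-diagonal = ℕ-Solver.solve-∀

T₃-next-diagonal : ∀ p d e → suc (suc p + d) + (p + e) ≡ suc (suc (p + d + e)) + p
T₃-next-diagonal = ℕ-Solver.solve-∀

T₃-next-diagonal-shifted : ∀ p d e → suc (suc p + d) + (suc p + e) ≡ suc (suc (p + d + e)) + suc p
T₃-next-diagonal-shifted = ℕ-Solver.solve-∀

rc2⇔ic1-T₃ : ∀ {n} (h : HArray) {p d e} → Gap n p d e →
  RC2-at h (suc p) (suc p + e) ⇔ IC1-at (T₃ n h) (suc p + d) (suc p)
rc2⇔ic1-T₃ h {p} {d} {e} refl
  = by-entries (T₃-entry h {suc p + d} {p} {suc p + e} (T₃-diagonal p d e))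
               (T₃-entry h {suc (suc p + d)} {p} {p + e} (T₃-next-diagonal p d e))
  $ sum≤sum⇔diff≤diff-right (h (suc p) (suc (suc p + e))) (h p (p + e))
                            (h p (suc p + e)) (h (suc p) (suc p + e))

rc3⇔ic2-T₃ : ∀ {n} (h : HArray) {p d e} → Gap n p d e →
  RC3-at h (suc p) (suc p + e) ⇔ IC2-at (T₃ n h) (suc p + d) (suc p)
rc3⇔ic2-T₃ h {p} {d} {e} refl
  = by-entries (T₃-entry {suc (suc (p + d + e))} h {suc (suc p + d)} {suc p} {suc p + e}
                         (T₃-next-diagonal-shifted p d e))
               (T₃-entry h {suc p + d} {p} {suc p + e} (T₃-diagonal p d e))
  $ sum≤sum⇔diff≤diff-right (h (suc (suc p)) (suc (suc p + e))) (h p (suc p + e))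
                            (h (suc p) (suc p + e)) (h (suc p) (suc (suc p + e)))

IC-gaps : ∀ {n} (P : ℕ → ℕ → Set) → 1 ≤ n →
  (∀ i j → 1 ≤ j → j ≤ i → i ≤ n ∸ 1 → P i j) ⇔ AllGaps n (λ p d e → P (suc p + d) (suc p))
IC-gaps P n≥1 = ⇔-trans (IC-triangle P n≥1) (triangle⇔gaps _)

RC≤-gaps : ∀ {n} (P : ℕ → ℕ → Set) →
  (∀ a b → 1 ≤ a → a ≤ b → b ℕ.< n → P a b) ⇔ AllGaps n (λ p d e → P (suc p) (suc p + d))
RC≤-gaps P = ⇔-trans (RC≤-triangle P) (triangle⇔gaps _)

RC<-gaps : ∀ {n} (P : ℕ → ℕ → Set) →
  (∀ a b → 1 ≤ a → a ℕ.< b → b ≤ n → P a b) ⇔ AllGaps n (λ p d e → P (suc p) (suc (suc p + d)))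
RC<-gaps P = ⇔-trans (RC<-triangle P) (triangle⇔gaps _)

module _ {n : ℕ} (n≥1 : 1 ≤ n) (h : HArray) where

  RC1⇔IC2-T₁ : RC1 n h ⇔ IC2 n (T₁ n h)
  RC1⇔IC2-T₁ = begin
    RC1 n h                                                        ≈⟨ RC<-gaps (RC1-at h) ⟩
    AllGaps n (λ p d e → RC1-at h (suc p) (suc (suc p + d)))       ≈⟨ gaps-rotate _ ⟩
    AllGaps n (λ p d e → RC1-at h (suc e) (suc (suc e + p)))       ≈⟨ gaps-cong (rc1⇔ic2-T₁ h) ⟩
    AllGaps n (λ p d e → IC2-at (T₁ n h) (suc p + d) (suc p))      ≈⟨ IC-gaps (IC2-at (T₁ n h)) n≥1 ⟨
    IC2 n (T₁ n h)                                                 ∎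

  RC1⇔IC1-T₂ : RC1 n h ⇔ IC1 n (T₂ n h)
  RC1⇔IC1-T₂ = begin
    RC1 n h                                                        ≈⟨ RC<-gaps (RC1-at h) ⟩
    AllGaps n (λ p d e → RC1-at h (suc p) (suc (suc p + d)))
      ≈⟨ gaps-cong (λ {p} {d} _ → rc1⇔ic1-T₂ {n} h p (suc p + d)) ⟩
    AllGaps n (λ p d e → IC1-at (T₂ n h) (suc p + d) (suc p))      ≈⟨ IC-gaps (IC1-at (T₂ n h)) n≥1 ⟨
    IC1 n (T₂ n h)                                                 ∎

  RC2⇔IC1-T₁ : RC2 n h ⇔ IC1 n (T₁ n h)
  RC2⇔IC1-T₁ = begin
    RC2 n h                                                        ≈⟨ RC≤-gaps (RC2-at h) ⟩
    AllGaps n (λ p d e → RC2-at h (suc p) (suc p + d))             ≈⟨ gaps-rotate _ ⟩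
    AllGaps n (λ p d e → RC2-at h (suc e) (suc e + p))             ≈⟨ gaps-cong (rc2⇔ic1-T₁ h) ⟩
    AllGaps n (λ p d e → IC1-at (T₁ n h) (suc p + d) (suc p))      ≈⟨ IC-gaps (IC1-at (T₁ n h)) n≥1 ⟨
    IC1 n (T₁ n h)                                                 ∎

  RC2⇔IC1-T₃ : RC2 n h ⇔ IC1 n (T₃ n h)
  RC2⇔IC1-T₃ = begin
    RC2 n h                                                        ≈⟨ RC≤-gaps (RC2-at h) ⟩
    AllGaps n (λ p d e → RC2-at h (suc p) (suc p + d))             ≈⟨ gaps-swap _ ⟩
    AllGaps n (λ p d e → RC2-at h (suc p) (suc p + e))             ≈⟨ gaps-cong (rc2⇔ic1-T₃ h) ⟩
    AllGaps n (λ p d e → IC1-at (T₃ n h) (suc p + d) (suc p))      ≈⟨ IC-gaps (IC1-at (T₃ n h)) n≥1 ⟨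
    IC1 n (T₃ n h)                                                 ∎

  RC3⇔IC2-T₂ : RC3 n h ⇔ IC2 n (T₂ n h)
  RC3⇔IC2-T₂ = begin
    RC3 n h                                                        ≈⟨ RC≤-gaps (RC3-at h) ⟩
    AllGaps n (λ p d e → RC3-at h (suc p) (suc p + d))
      ≈⟨ gaps-cong (λ {p} {d} _ → rc3⇔ic2-T₂ {n} h p (suc p + d)) ⟩
    AllGaps n (λ p d e → IC2-at (T₂ n h) (suc p + d) (suc p))      ≈⟨ IC-gaps (IC2-at (T₂ n h)) n≥1 ⟨
    IC2 n (T₂ n h)                                                 ∎

  RC3⇔IC2-T₃ : RC3 n h ⇔ IC2 n (T₃ n h)
  RC3⇔IC2-T₃ = begin
    RC3 n h                                                        ≈⟨ RC≤-gaps (RC3-at h) ⟩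
    AllGaps n (λ p d e → RC3-at h (suc p) (suc p + d))             ≈⟨ gaps-swap _ ⟩
    AllGaps n (λ p d e → RC3-at h (suc p) (suc p + e))             ≈⟨ gaps-cong (rc3⇔ic2-T₃ h) ⟩
    AllGaps n (λ p d e → IC2-at (T₃ n h) (suc p + d) (suc p))      ≈⟨ IC-gaps (IC2-at (T₃ n h)) n≥1 ⟨
    IC2 n (T₃ n h)                                                 ∎

⇔-pair : ∀ {A B C : Set} → A ⇔ B → A ⇔ C → A ⇔ (B × C)
⇔-pair A⇔B A⇔C = mk⇔ (λ a → Equivalence.to A⇔B a , Equivalence.to A⇔C a)
                     (λ b×c → Equivalence.from A⇔B (proj₁ b×c))

proposition2p4 : (n : ℕ) → 1 ≤ n → (h : HArray) → IsHArray h →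
    (RC1 n h ⇔ (IC2 n (T₁ n h) × IC1 n (T₂ n h)))
    × (RC2 n h ⇔ (IC1 n (T₁ n h) × IC1 n (T₃ n h)))
    × (RC3 n h ⇔ (IC2 n (T₂ n h) × IC2 n (T₃ n h)))
    × (IC1 n (T₃ n h) ⇔ IC1 n (T₁ n h))
    × (IC2 n (T₃ n h) ⇔ IC2 n (T₂ n h))
proposition2p4 n n≥1 h _ =
    ⇔-pair (RC1⇔IC2-T₁ n≥1 h) (RC1⇔IC1-T₂ n≥1 h)
  , ⇔-pair (RC2⇔IC1-T₁ n≥1 h) (RC2⇔IC1-T₃ n≥1 h)
  , ⇔-pair (RC3⇔IC2-T₂ n≥1 h) (RC3⇔IC2-T₃ n≥1 h)
  , ⇔-trans (⇔-sym (RC2⇔IC1-T₃ n≥1 h)) (RC2⇔IC1-T₁ n≥1 h)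
  , ⇔-trans (⇔-sym (RC3⇔IC2-T₃ n≥1 h)) (RC3⇔IC2-T₂ n≥1 h)
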